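{- For every $\sigma\in\mathfrak{S}_n$, $\mathsf{Inv}(\sigma)=\langle A(\sigma)\rangle$.
   Context: $\mathfrak{S}_n$ is the symmetric group on $[n]$, permutations in one-line notation $\sigma=\sigma_1\cdots\sigma_n$. Lehmer code: $\mathsf{Leh}(\sigma)=(\ell_1,\dots,\ell_n)$ with $\ell_i=\#\{j:1\le j\le i,\ \sigma_j\le\sigma_i\}$, valued in $\mathcal{L}_n=\{(\ell_1,\dots,\ell_n):1\le\ell_i\le i\}$; $A(\sigma)=\mathsf{Leh}(\sigma^{ -1})$. Induced set $\langle(\ell_1,\dots,\ell_n)\rangle$ of $(\ell_1,\dots,\ell_n)\in\mathcal{L}_n$: start with $S=[n]$, $U=\emptyset$; for $i=n,n-1,\dots,1$: let $\ell_i'$ be the $\ell_i$-th smallest element of $S$, add to $U$ all ordered pairs $(\ell_i',j)$ with $j\in S$, $j>\ell_i'$, then delete $\ell_i'$ from $S$; the final $U$ is $\langle(\ell_1,\dots,\ell_n)\rangle$. The inversion set is $\mathsf{Inv}(\sigma)=\{(i,j):i<j,\ \sigma_i>\sigma_j\}$. -}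

module Defs where

open import Data.Nat using (ℕ; zero; suc; _≤_; _<_; _>_; _≤?_; _<?_)
open import Data.Fin using (Fin; toℕ)
open import Data.Fin.Permutation using (Permutation′; _⟨$⟩ʳ_; _⟨$⟩ˡ_)
open import Data.List using (List; []; _∷_; _++_; length; filter; map; allFin; reverse; upTo)
open import Data.Vec as V using (Vec)
open import Data.Product using (_×_; _,_; Σ; ∃)
open import Data.Maybe using (Maybe; just; nothing)
open import Data.List.Membership.Propositional using (_∈_)
open import Relation.Binary.PropositionalEquality using (_≡_)
open import Relation.Nullary.Decidable using (_×-dec_)

-- Convention: positions and values of σ ∈ 𝔖_n are Fin n (0-based);
-- position/value k : Fin n stands for the element toℕ k + 1 of [n].
-- Lehmer codes and the pairs of inversion / induced sets are written
-- 1-based in ℕ, exactly as in the paper.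

Leh : ∀ {n} → (Fin n → Fin n) → Vec ℕ n
Leh {n} τ = V.tabulate λ i →
  length (filter (λ j → (toℕ j ≤? toℕ i) ×-dec (toℕ (τ j) ≤? toℕ (τ i))) (allFin n))

A : ∀ {n} → Permutation′ n → Vec ℕ n
A σ = Leh (σ ⟨$⟩ˡ_)

-- the k-th smallest (1-based k) element of a list kept in increasing order,
-- together with the list with that element deleted
select : ℕ → List ℕ → Maybe (ℕ × List ℕ)
select _ [] = nothing
select zero (x ∷ xs) = nothing
select (suc zero) (x ∷ xs) = just (x , xs)
select (suc (suc k)) (x ∷ xs) with select (suc k) xs
... | nothing = nothing
... | just (y , ys) = just (y , x ∷ ys)

-- the induced-set algorithm; codes are consumed in the order ℓ_n, ℓ_{n-1}, …, ℓ_1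
inducedLoop : List ℕ → List ℕ → List (ℕ × ℕ)
inducedLoop S [] = []
inducedLoop S (k ∷ ks) with select k S
... | nothing = inducedLoop S ks   -- never happens for codes in 𝓛_n
... | just (x , S′) = map (λ j → (x , j)) (filter (λ j → x <? j) S) ++ inducedLoop S′ ks

range1 : ℕ → List ℕ
range1 n = map suc (upTo n)

Induced : ∀ {n} → Vec ℕ n → List (ℕ × ℕ)
Induced {n} ℓ = inducedLoop (range1 n) (reverse (V.toList ℓ))

InInv : ∀ {n} → Permutation′ n → ℕ × ℕ → Set
InInv {n} σ (a , b) = Σ (Fin n) λ i → Σ (Fin n) λ j →
  (a ≡ suc (toℕ i)) × (b ≡ suc (toℕ j)) × (toℕ i < toℕ j) × (toℕ (σ ⟨$⟩ʳ i) > toℕ (σ ⟨$⟩ʳ j))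

-- Reading the code ℓ_n, …, ℓ_1 of A(σ) = Leh(σ⁻¹) handles the values n, …, 1 of σ one at a
-- time, and just before value v is handled, S is the set of positions holding values below v.
-- The entry of A(σ) for v counts the positions ≤ σ⁻¹(v) holding values ≤ v, i.e. it is the rank
-- of σ⁻¹(v) in S, so the step selects the position σ⁻¹(v) and adds the pairs (σ⁻¹(v), j) with
-- j > σ⁻¹(v) and σ_j < v: exactly the inversions whose first entry has value v.
module Submission where

open import Defs
open import Data.Nat using (ℕ; zero; suc; _≤_; _<_; _≤?_; _<?_; _≟_; s≤s; z≤n; s≤s⁻¹)
open import Data.Nat.Properties
  using (≤-refl; <-irrefl; <⇒≤; <⇒≢; <⇒≱; suc-injective; m<n⇒m<1+n; m<1+n⇒m<n∨m≡n; ≤∧≢⇒<)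
open import Data.Fin as Fin using (Fin; toℕ)
open import Data.Fin.Properties using (toℕ-injective; toℕ<n)
open import Data.Fin.Permutation using (Permutation′; _⟨$⟩ʳ_; _⟨$⟩ˡ_; inverseˡ; inverseʳ)
open import Data.List
  using (List; []; _∷_; _++_; length; filter; map; tabulate; allFin; reverse; upTo; downFrom; applyUpTo)
open import Data.List.Properties
  using (filter-accept; filter-reject; filter-all; filter-none; filter-some; filter-≐;
         length-map; map-tabulate; map-upTo; reverse-map; reverse-upTo; ∷-injectiveˡ; ∷-injectiveʳ)
open import Data.List.Membership.Propositional using (_∈_; lose)
open import Data.List.Membership.Propositional.Properties
  using (∈-map⁺; ∈-map⁻; ∈-filter⁺; ∈-filter⁻; ∈-allFin)
open import Data.List.Membership.Propositional.Properties.WithK using (unique∧set⇒bag)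
open import Data.List.Relation.Unary.All as All using ()
open import Data.List.Relation.Unary.Any using (here; there)
import Data.List.Relation.Unary.Any.Properties as Any
open import Data.List.Relation.Unary.AllPairs using (AllPairs; _∷_)
import Data.List.Relation.Unary.AllPairs.Properties as AllPairs
import Data.List.Relation.Unary.Unique.Propositional.Properties as Unique
open import Data.List.Relation.Binary.BagAndSetEquality using (∼bag⇒↭)
open import Data.List.Relation.Binary.Permutation.Propositional using (_↭_)
open import Data.List.Relation.Binary.Permutation.Propositional.Properties using (filter-↭; ↭-length)
import Data.Vec as V
open import Data.Product using (_×_; _,_; Σ; proj₁; proj₂; ∃)
open import Data.Sum using (_⊎_; inj₁; inj₂; [_,_])
open import Data.Sum.Function.Propositional using (_⊎-⇔_)
open import Data.Maybe using (just)
open import Function using (_∘_)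
open import Function.Bundles using (_⇔_; mk⇔)
open import Function.Properties.Equivalence using () renaming (sym to ⇔-sym)
open import Function.Related.Propositional using (module EquationalReasoning)
open import Relation.Nullary using (¬?; yes; no)
open import Relation.Nullary.Decidable using (_×-dec_)
open import Relation.Unary using (Decidable)
open import Relation.Binary.PropositionalEquality
  using (_≡_; _≢_; refl; sym; trans; cong; cong₂; subst; module ≡-Reasoning)

private variable
  X Y : Set

toList-tabulate : ∀ {n} (f : Fin n → X) → V.toList (V.tabulate f) ≡ tabulate f
toList-tabulate {n = zero}  f = refl
toList-tabulate {n = suc n} f = cong (f Fin.zero ∷_) (toList-tabulate (f ∘ Fin.suc))

tabulate-∘toℕ : ∀ n (f : ℕ → X) → tabulate {n = n} (f ∘ toℕ) ≡ applyUpTo f n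
tabulate-∘toℕ zero    f = refl
tabulate-∘toℕ (suc n) f = cong (f 0 ∷_) (tabulate-∘toℕ n (f ∘ suc))

map-toℕ-reverse-allFin : ∀ n → map toℕ (reverse (allFin n)) ≡ downFrom n
map-toℕ-reverse-allFin n = begin
  map toℕ (reverse (allFin n))    ≡⟨ reverse-map toℕ (allFin n) ⟩
  reverse (map toℕ (allFin n))    ≡⟨ cong reverse (map-tabulate {n = n} (λ i → i) toℕ) ⟩
  reverse (tabulate {n = n} toℕ)  ≡⟨ cong reverse (tabulate-∘toℕ n (λ k → k)) ⟩
  reverse (upTo n)                ≡⟨ reverse-upTo n ⟩
  downFrom n                      ∎
  where open ≡-Reasoning

module _ {P : Y → Set} (P? : Decidable P) where

  filter-map : (f : X → Y) (xs : List X) → filter P? (map f xs) ≡ map f (filter (P? ∘ f) xs)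
  filter-map f [] = refl
  filter-map f (x ∷ xs) with P? (f x)
  ... | yes _ = cong (f x ∷_) (filter-map f xs)
  ... | no  _ = filter-map f xs

module _ {P Q : X → Set} (P? : Decidable P) (Q? : Decidable Q) where

  filter-×-dec : (xs : List X) → filter (λ x → P? x ×-dec Q? x) xs ≡ filter Q? (filter P? xs)
  filter-×-dec [] = refl
  filter-×-dec (x ∷ xs) with P? x | Q? x
  ... | yes _ | yes q = trans (cong (x ∷_) (filter-×-dec xs)) (sym (filter-accept Q? q))
  ... | yes _ | no ¬q = trans (filter-×-dec xs) (sym (filter-reject Q? ¬q))
  ... | no  _ | yes _ = filter-×-dec xs
  ... | no  _ | no  _ = filter-×-dec xs

allFin-↭-map : ∀ {n} (π : Permutation′ n) → allFin n ↭ map (π ⟨$⟩ʳ_) (allFin n)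
allFin-↭-map {n} π = ∼bag⇒↭ (unique∧set⇒bag
  (Unique.allFin⁺ n)
  (Unique.map⁺ π-injective (Unique.allFin⁺ n))
  (λ {x} → mk⇔ (λ _ → subst (_∈ map (π ⟨$⟩ʳ_) (allFin n)) (inverseʳ π) (∈-map⁺ _ (∈-allFin _)))
               (λ _ → ∈-allFin x)))
  where
  π-injective : ∀ {i j} → π ⟨$⟩ʳ i ≡ π ⟨$⟩ʳ j → i ≡ j
  π-injective {i} {j} eq = trans (sym (inverseˡ π)) (trans (cong (π ⟨$⟩ˡ_) eq) (inverseˡ π))

length-filter-allFin-∘ : ∀ {n} {P : Fin n → Set} (P? : Decidable P) (π : Permutation′ n) →
  length (filter P? (allFin n)) ≡ length (filter (P? ∘ (π ⟨$⟩ʳ_)) (allFin n))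
length-filter-allFin-∘ {n} P? π = begin
  length (filter P? (allFin n))
    ≡⟨ ↭-length (filter-↭ P? (allFin-↭-map π)) ⟩
  length (filter P? (map (π ⟨$⟩ʳ_) (allFin n)))
    ≡⟨ cong length (filter-map P? (π ⟨$⟩ʳ_) (allFin n)) ⟩
  length (map (π ⟨$⟩ʳ_) (filter (P? ∘ (π ⟨$⟩ʳ_)) (allFin n)))
    ≡⟨ length-map (π ⟨$⟩ʳ_) (filter (P? ∘ (π ⟨$⟩ʳ_)) (allFin n)) ⟩
  length (filter (P? ∘ (π ⟨$⟩ʳ_)) (allFin n)) ∎
  where open ≡-Reasoning

select-cons : ∀ {k xs y ys} x → 0 < k → select k xs ≡ just (y , ys) →
  select (suc k) (x ∷ xs) ≡ just (y , x ∷ ys)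
select-cons x (s≤s z≤n) eq rewrite eq = refl

select-rank : ∀ {xs y} → AllPairs _<_ xs → y ∈ xs →
  select (length (filter (_≤? y) xs)) xs ≡ just (y , filter (λ x → ¬? (x ≟ y)) xs)
select-rank {x ∷ xs} (x<xs ∷ _) (here refl) = begin
  select (length (filter (_≤? x) (x ∷ xs))) (x ∷ xs)
    ≡⟨ cong (λ ys → select (length ys) (x ∷ xs)) (filter-accept (_≤? x) ≤-refl) ⟩
  select (suc (length (filter (_≤? x) xs))) (x ∷ xs)
    ≡⟨ cong (λ ys → select (suc (length ys)) (x ∷ xs)) (filter-none (_≤? x) (All.map <⇒≱ x<xs)) ⟩
  just (x , xs)
    ≡⟨ cong (λ ys → just (x , ys)) (filter-all _ (All.map (λ x<z z≡x → <⇒≢ x<z (sym z≡x)) x<xs)) ⟨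
  just (x , filter (λ z → ¬? (z ≟ x)) xs)
    ≡⟨ cong (λ ys → just (x , ys)) (filter-reject (λ z → ¬? (z ≟ x)) (λ x≢x → x≢x refl)) ⟨
  just (x , filter (λ z → ¬? (z ≟ x)) (x ∷ xs)) ∎
  where open ≡-Reasoning
select-rank {x ∷ xs} {y} (x<xs ∷ sorted) (there y∈xs) = begin
  select (length (filter (_≤? y) (x ∷ xs))) (x ∷ xs)
    ≡⟨ cong (λ ys → select (length ys) (x ∷ xs)) (filter-accept (_≤? y) (<⇒≤ x<y)) ⟩
  select (suc (length (filter (_≤? y) xs))) (x ∷ xs)
    ≡⟨ select-cons x (filter-some (_≤? y) (lose y∈xs ≤-refl)) (select-rank sorted y∈xs) ⟩
  just (y , x ∷ filter (λ z → ¬? (z ≟ y)) xs)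
    ≡⟨ cong (λ ys → just (y , ys)) (filter-accept (λ z → ¬? (z ≟ y)) (<⇒≢ x<y)) ⟨
  just (y , filter (λ z → ¬? (z ≟ y)) (x ∷ xs)) ∎
  where
  open ≡-Reasoning
  x<y : x < y
  x<y = All.lookup x<xs y∈xs

inducedLoop-select : ∀ {S k ks x S′} → select k S ≡ just (x , S′) →
  inducedLoop S (k ∷ ks) ≡ map (x ,_) (filter (x <?_) S) ++ inducedLoop S′ ks
inducedLoop-select eq rewrite eq = refl

lehmerEntry : ∀ {n} → (Fin n → Fin n) → Fin n → ℕ
lehmerEntry {n} τ i =
  length (filter (λ j → (toℕ j ≤? toℕ i) ×-dec (toℕ (τ j) ≤? toℕ (τ i))) (allFin n))

reverse-toList-Leh : ∀ {n} (τ : Fin n → Fin n) →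
  reverse (V.toList (Leh τ)) ≡ map (lehmerEntry τ) (reverse (allFin n))
reverse-toList-Leh {n} τ = begin
  reverse (V.toList (V.tabulate (lehmerEntry τ)))  ≡⟨ cong reverse (toList-tabulate (lehmerEntry τ)) ⟩
  reverse (tabulate (lehmerEntry τ))               ≡⟨ cong reverse (map-tabulate (λ i → i) (lehmerEntry τ)) ⟨
  reverse (map (lehmerEntry τ) (allFin n))         ≡⟨ reverse-map (lehmerEntry τ) (allFin n) ⟨
  map (lehmerEntry τ) (reverse (allFin n))         ∎
  where open ≡-Reasoning

toℕ₁ : ∀ {n} → Fin n → ℕ
toℕ₁ i = suc (toℕ i)

module _ {n : ℕ} (σ : Permutation′ n) where

  positionsBelow : ℕ → List ℕ
  positionsBelow m = map toℕ₁ (filter (λ i → toℕ (σ ⟨$⟩ʳ i) <? m) (allFin n))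

  InInvBelow : ℕ → ℕ × ℕ → Set
  InInvBelow m p = Σ (InInv σ p) λ inv → toℕ (σ ⟨$⟩ʳ proj₁ inv) < m

  InInvAt : ℕ → ℕ × ℕ → Set
  InInvAt m p = Σ (InInv σ p) λ inv → toℕ (σ ⟨$⟩ʳ proj₁ inv) ≡ m

  positionsBelow-sorted : ∀ m → AllPairs _<_ (positionsBelow m)
  positionsBelow-sorted m = AllPairs.map⁺ (AllPairs.filter⁺ _ (AllPairs.tabulate⁺-< s≤s))

  ∈-positionsBelow⁺ : ∀ {m i} → toℕ (σ ⟨$⟩ʳ i) < m → toℕ₁ i ∈ positionsBelow m
  ∈-positionsBelow⁺ σi<m = ∈-map⁺ toℕ₁ (∈-filter⁺ _ (∈-allFin _) σi<m)

  ∈-positionsBelow⁻ : ∀ {m x} → x ∈ positionsBelow m → ∃ λ i → x ≡ toℕ₁ i × toℕ (σ ⟨$⟩ʳ i) < m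
  ∈-positionsBelow⁻ x∈ with ∈-map⁻ toℕ₁ x∈
  ... | i , i∈ , refl = i , refl , proj₂ (∈-filter⁻ _ {xs = allFin n} i∈)

  σ⁻¹-unique : ∀ {i v} → toℕ (σ ⟨$⟩ʳ i) ≡ toℕ v → i ≡ σ ⟨$⟩ˡ v
  σ⁻¹-unique eq = trans (sym (inverseˡ σ)) (cong (σ ⟨$⟩ˡ_) (toℕ-injective eq))

  lehmerEntry-rank : ∀ v → let y = σ ⟨$⟩ˡ v in
    lehmerEntry (σ ⟨$⟩ˡ_) v ≡ length (filter (_≤? toℕ₁ y) (positionsBelow (suc (toℕ v))))
  lehmerEntry-rank v = begin
    lehmerEntry (σ ⟨$⟩ˡ_) v
      ≡⟨ length-filter-allFin-∘ _ σ ⟩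
    length (filter (λ i → (toℕ (σ ⟨$⟩ʳ i) ≤? toℕ v) ×-dec (toℕ (σ ⟨$⟩ˡ (σ ⟨$⟩ʳ i)) ≤? toℕ y)) (allFin n))
      ≡⟨ cong length (filter-≐ _ _ (reindex , unreindex) (allFin n)) ⟩
    length (filter (λ i → below i ×-dec (toℕ₁ i ≤? toℕ₁ y)) (allFin n))
      ≡⟨ cong length (filter-×-dec below (λ i → toℕ₁ i ≤? toℕ₁ y) (allFin n)) ⟩
    length (filter (λ i → toℕ₁ i ≤? toℕ₁ y) (filter below (allFin n)))
      ≡⟨ length-map toℕ₁ (filter (λ i → toℕ₁ i ≤? toℕ₁ y) (filter below (allFin n))) ⟨
    length (map toℕ₁ (filter (λ i → toℕ₁ i ≤? toℕ₁ y) (filter below (allFin n))))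
      ≡⟨ cong length (filter-map (_≤? toℕ₁ y) toℕ₁ (filter below (allFin n))) ⟨
    length (filter (_≤? toℕ₁ y) (positionsBelow (suc (toℕ v)))) ∎
    where
    open ≡-Reasoning
    y = σ ⟨$⟩ˡ v
    below = λ i → toℕ (σ ⟨$⟩ʳ i) <? suc (toℕ v)
    reindex : ∀ {i} → toℕ (σ ⟨$⟩ʳ i) ≤ toℕ v × toℕ (σ ⟨$⟩ˡ (σ ⟨$⟩ʳ i)) ≤ toℕ y →
              toℕ (σ ⟨$⟩ʳ i) < suc (toℕ v) × toℕ₁ i ≤ toℕ₁ y
    reindex (σi≤v , i≤y) = s≤s σi≤v , s≤s (subst (λ j → toℕ j ≤ toℕ y) (inverseˡ σ) i≤y)
    unreindex : ∀ {i} → toℕ (σ ⟨$⟩ʳ i) < suc (toℕ v) × toℕ₁ i ≤ toℕ₁ y →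
                toℕ (σ ⟨$⟩ʳ i) ≤ toℕ v × toℕ (σ ⟨$⟩ˡ (σ ⟨$⟩ʳ i)) ≤ toℕ y
    unreindex (σi<1+v , i≤y) =
      s≤s⁻¹ σi<1+v , subst (λ j → toℕ j ≤ toℕ y) (sym (inverseˡ σ)) (s≤s⁻¹ i≤y)

  positionsBelow-remove : ∀ v → let y = σ ⟨$⟩ˡ v in
    filter (λ x → ¬? (x ≟ toℕ₁ y)) (positionsBelow (suc (toℕ v))) ≡ positionsBelow (toℕ v)
  positionsBelow-remove v = begin
    filter ≢y? (map toℕ₁ (filter below (allFin n)))
      ≡⟨ filter-map ≢y? toℕ₁ (filter below (allFin n)) ⟩
    map toℕ₁ (filter (≢y? ∘ toℕ₁) (filter below (allFin n)))
      ≡⟨ cong (map toℕ₁) (filter-×-dec below (≢y? ∘ toℕ₁) (allFin n)) ⟨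
    map toℕ₁ (filter (λ i → below i ×-dec ≢y? (toℕ₁ i)) (allFin n))
      ≡⟨ cong (map toℕ₁) (filter-≐ _ _ (drop-v , keep-v) (allFin n)) ⟩
    positionsBelow (toℕ v) ∎
    where
    open ≡-Reasoning
    y = σ ⟨$⟩ˡ v
    ≢y? = λ x → ¬? (x ≟ toℕ₁ y)
    below = λ i → toℕ (σ ⟨$⟩ʳ i) <? suc (toℕ v)
    drop-v : ∀ {i} → toℕ (σ ⟨$⟩ʳ i) < suc (toℕ v) × toℕ₁ i ≢ toℕ₁ y → toℕ (σ ⟨$⟩ʳ i) < toℕ v
    drop-v (σi<1+v , i≢y) = ≤∧≢⇒< (s≤s⁻¹ σi<1+v) (i≢y ∘ cong toℕ₁ ∘ σ⁻¹-unique)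
    keep-v : ∀ {i} → toℕ (σ ⟨$⟩ʳ i) < toℕ v → toℕ (σ ⟨$⟩ʳ i) < suc (toℕ v) × toℕ₁ i ≢ toℕ₁ y
    keep-v σi<v = m<n⇒m<1+n σi<v , λ i≡y →
      <⇒≢ σi<v (cong toℕ (trans (cong (σ ⟨$⟩ʳ_) (toℕ-injective (suc-injective i≡y))) (inverseʳ σ)))

  addedPairs : Fin n → List (ℕ × ℕ)
  addedPairs v = map (toℕ₁ y ,_) (filter (toℕ₁ y <?_) (positionsBelow (suc (toℕ v))))
    where y = σ ⟨$⟩ˡ v

  select-positionsBelow : ∀ v →
    select (lehmerEntry (σ ⟨$⟩ˡ_) v) (positionsBelow (suc (toℕ v)))
      ≡ just (toℕ₁ (σ ⟨$⟩ˡ v) , positionsBelow (toℕ v))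
  select-positionsBelow v = begin
    select (lehmerEntry (σ ⟨$⟩ˡ_) v) S
      ≡⟨ cong (λ k → select k S) (lehmerEntry-rank v) ⟩
    select (length (filter (_≤? toℕ₁ y) S)) S
      ≡⟨ select-rank (positionsBelow-sorted _) (∈-positionsBelow⁺ σy<1+v) ⟩
    just (toℕ₁ y , filter (λ x → ¬? (x ≟ toℕ₁ y)) S)
      ≡⟨ cong (λ S′ → just (toℕ₁ y , S′)) (positionsBelow-remove v) ⟩
    just (toℕ₁ y , positionsBelow (toℕ v)) ∎
    where
    open ≡-Reasoning
    y = σ ⟨$⟩ˡ v
    S = positionsBelow (suc (toℕ v))
    σy<1+v : toℕ (σ ⟨$⟩ʳ y) < suc (toℕ v)
    σy<1+v = subst (λ j → toℕ j < suc (toℕ v)) (sym (inverseʳ σ)) ≤-refl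

  ∈-addedPairs : ∀ v p → p ∈ addedPairs v ⇔ InInvAt (toℕ v) p
  ∈-addedPairs v (a , b) = mk⇔ to from
    where
    y = σ ⟨$⟩ˡ v
    σy≡v : toℕ (σ ⟨$⟩ʳ y) ≡ toℕ v
    σy≡v = cong toℕ (inverseʳ σ)
    to : (a , b) ∈ addedPairs v → InInvAt (toℕ v) (a , b)
    to p∈ with ∈-map⁻ (toℕ₁ y ,_) p∈
    ... | x , x∈ , refl with ∈-filter⁻ (toℕ₁ y <?_) {xs = positionsBelow (suc (toℕ v))} x∈
    ... | x∈′ , y<x with ∈-positionsBelow⁻ x∈′
    ... | j , refl , σj<1+v = (y , j , refl , refl , y<j , σj<σy) , σy≡v
      where
      y<j = s≤s⁻¹ y<x
      σj≢v : toℕ (σ ⟨$⟩ʳ j) ≢ toℕ v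
      σj≢v eq = <-irrefl (cong toℕ (sym (σ⁻¹-unique eq))) y<j
      σj<σy = subst (toℕ (σ ⟨$⟩ʳ j) <_) (sym σy≡v) (≤∧≢⇒< (s≤s⁻¹ σj<1+v) σj≢v)
    from : InInvAt (toℕ v) (a , b) → (a , b) ∈ addedPairs v
    from ((i , j , refl , refl , i<j , σj<σi) , σi≡v) with refl ← σ⁻¹-unique σi≡v =
      ∈-map⁺ (toℕ₁ y ,_) (∈-filter⁺ (toℕ₁ y <?_) (∈-positionsBelow⁺ σj<1+v) (s≤s i<j))
      where σj<1+v = m<n⇒m<1+n (subst (toℕ (σ ⟨$⟩ʳ j) <_) σi≡v σj<σi)

  InInvBelow-suc : ∀ m p → InInvBelow (suc m) p ⇔ (InInvAt m p ⊎ InInvBelow m p)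
  InInvBelow-suc m p = mk⇔ split [ at , below ]
    where
    split : InInvBelow (suc m) p → InInvAt m p ⊎ InInvBelow m p
    split (inv , lt) with m<1+n⇒m<n∨m≡n lt
    ... | inj₁ σi<m = inj₂ (inv , σi<m)
    ... | inj₂ σi≡m = inj₁ (inv , σi≡m)
    at : InInvAt m p → InInvBelow (suc m) p
    at (inv , σi≡m) = inv , subst (_< suc m) (sym σi≡m) ≤-refl
    below : InInvBelow m p → InInvBelow (suc m) p
    below (inv , σi<m) = inv , m<n⇒m<1+n σi<m

  ∈-inducedLoop-positionsBelow : ∀ m vs → map toℕ vs ≡ downFrom m → ∀ p →
    p ∈ inducedLoop (positionsBelow m) (map (lehmerEntry (σ ⟨$⟩ˡ_)) vs) ⇔ InInvBelow m p
  ∈-inducedLoop-positionsBelow zero [] _ p = mk⇔ (λ ()) λ ()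
  ∈-inducedLoop-positionsBelow (suc m) (v ∷ vs) eq p with refl ← ∷-injectiveˡ eq = begin
    p ∈ inducedLoop (positionsBelow (suc (toℕ v))) (map code (v ∷ vs))
      ≡⟨ cong (p ∈_) (inducedLoop-select {S = positionsBelow (suc (toℕ v))} {ks = map code vs}
                                         (select-positionsBelow v)) ⟩
    p ∈ addedPairs v ++ inducedLoop (positionsBelow (toℕ v)) (map code vs)
      ↔⟨ Any.++↔ ⟨
    (p ∈ addedPairs v ⊎ p ∈ inducedLoop (positionsBelow (toℕ v)) (map code vs))
      ∼⟨ ∈-addedPairs v p ⊎-⇔ ∈-inducedLoop-positionsBelow (toℕ v) vs (∷-injectiveʳ eq) p ⟩
    (InInvAt (toℕ v) p ⊎ InInvBelow (toℕ v) p)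
      ∼⟨ ⇔-sym (InInvBelow-suc (toℕ v) p) ⟩
    InInvBelow (suc (toℕ v)) p ∎
    where
    open EquationalReasoning
    code = lehmerEntry (σ ⟨$⟩ˡ_)

  positionsBelow-range1 : positionsBelow n ≡ range1 n
  positionsBelow-range1 = begin
    map toℕ₁ (filter (λ i → toℕ (σ ⟨$⟩ʳ i) <? n) (allFin n))
      ≡⟨ cong (map toℕ₁) (filter-all _ (All.universal (λ i → toℕ<n (σ ⟨$⟩ʳ i)) (allFin n))) ⟩
    map toℕ₁ (allFin n)  ≡⟨ map-tabulate (λ i → i) toℕ₁ ⟩
    tabulate toℕ₁        ≡⟨ tabulate-∘toℕ n suc ⟩
    applyUpTo suc n      ≡⟨ map-upTo suc n ⟨
    range1 n             ∎
    where open ≡-Reasoning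

proposition2p5 : (n : ℕ) (σ : Permutation′ n) (p : ℕ × ℕ) → InInv σ p ⇔ (p ∈ Induced (A σ))
proposition2p5 n σ p = begin
  InInv σ p
    ∼⟨ mk⇔ (λ inv → inv , toℕ<n (σ ⟨$⟩ʳ proj₁ inv)) proj₁ ⟩
  InInvBelow σ n p
    ∼⟨ ⇔-sym (∈-inducedLoop-positionsBelow σ n (reverse (allFin n)) (map-toℕ-reverse-allFin n) p) ⟩
  p ∈ inducedLoop (positionsBelow σ n) (map (lehmerEntry (σ ⟨$⟩ˡ_)) (reverse (allFin n)))
    ≡⟨ cong₂ (λ S ks → p ∈ inducedLoop S ks) (positionsBelow-range1 σ) (sym (reverse-toList-Leh (σ ⟨$⟩ˡ_))) ⟩
  p ∈ Induced (A σ) ∎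
  where open EquationalReasoning
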